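{- Let $T[1\,..\,n]$ be a string, $1\le\tau\le n/2$, and $\mathsf{Q}=\{i\in[1\,..\,n-\tau+1]:\mathrm{per}(T[i\,..\,i+\tau))\le\tau/3\}$. If an interval $[l\,..\,r]\subseteq[1\,..\,n-\tau+1]$ has length $r-l+1\le\tau/3$, then $[l\,..\,r]\cap\mathsf{Q}$ is either empty or an interval of consecutive integers.
   Context: A positive integer $p\le|S|$ is a period of $S$ if $S[i]=S[i+p]$ for all $1\le i\le|S|-p$; $\mathrm{per}(S)$ denotes the smallest period. $[i\,..\,j]$ denotes the integers from $i$ to $j$ and $T[i\,..\,j)=T[i]\cdots T[j-1]$. -}

module Defs where

open import Data.Nat using (ℕ; zero; suc; _+_; _*_; _∸_; _≤_; _<_)
open import Data.Fin using (Fin; fromℕ<)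
open import Data.Product using (Σ; _×_)
open import Relation.Binary.PropositionalEquality using (_≡_)

-- A string T[1..n] over alphabet A is a function Fin n → A;
-- the 1-based character T[j] (1 ≤ j ≤ n) is T (fromℕ< (j-1 < n)).

IsPeriod : {A : Set} {n : ℕ} → (Fin n → A) → (i len p : ℕ) → Set
IsPeriod {n = n} T i len p =
  1 ≤ p × p ≤ len ×
  ((j : ℕ) → i ≤ j → j + p < i + len →
     (h₁ : j ∸ 1 < n) (h₂ : (j + p) ∸ 1 < n) →
     T (fromℕ< h₁) ≡ T (fromℕ< h₂))

IsPer : {A : Set} {n : ℕ} → (Fin n → A) → (i len q : ℕ) → Set
IsPer T i len q = IsPeriod T i len q × ((p : ℕ) → IsPeriod T i len p → q ≤ p)

-- Membership in Q = { i ∈ [1 .. n-τ+1] : per(T[i .. i+τ)) ≤ τ/3 }.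
-- (per ≤ τ/3 over the rationals is 3·per ≤ τ.)
InQ : {A : Set} {n : ℕ} → (Fin n → A) → (τ i : ℕ) → Set
InQ {n = n} T τ i =
  1 ≤ i × i ≤ n + 1 ∸ τ × Σ ℕ (λ q → IsPer T i τ q × 3 * q ≤ τ)

{-# OPTIONS --safe #-}
module Submission where

open import Defs
open import Data.Nat using (ℕ; zero; suc; _+_; _*_; _∸_; _≤_; _<_; _≤?_; _<?_)
open import Data.Nat.Properties
open import Data.Nat.Induction using (<-wellFounded)
open import Data.Nat.Tactic.RingSolver using (solve-∀)
open import Data.Fin using (Fin; fromℕ<)
open import Data.Product using (_,_)
open import Data.Sum using (inj₁; inj₂)
open import Induction.WellFounded using (Acc; acc)
open import Relation.Nullary using (yes; no)
open import Relation.Nullary.Negation using (contradiction)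
open import Relation.Binary.PropositionalEquality
open import Algebra.Properties.CommutativeSemigroup +-commutativeSemigroup using (xy∙z≈xz∙y)

-- Two windows of length τ starting less than τ/3 apart overlap in at least
-- p + q positions when their smallest periods p, q are at most τ/3.  Across
-- such an overlap a period of either window propagates to the whole of the
-- other one, so each window has both periods and p = q.  Every window in
-- between lies in the union of the two, which has period p, and a smaller
-- period of it would propagate back to the first window.

block-induction : (P : ℕ → Set) (s p : ℕ) → 1 ≤ p →
  (∀ j → s ≤ j → j < s + p → P j) →
  (∀ j → s ≤ j → P j → P (j + p)) →
  (∀ j → j < s → P (j + p) → P j) →
  ∀ j → P j
block-induction P s p 1≤p block up down j = from-below s j (m≤n+m s j)
  where
  from-above : ∀ j → Acc _<_ j → s ≤ j → P j
  from-above j (acc rec) s≤j with j <? s + p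
  ... | yes j<s+p = block j s≤j j<s+p
  ... | no j≮s+p =
    subst P (m∸n+n≡m p≤j) (up (j ∸ p) s≤j∸p (from-above (j ∸ p) (rec j∸p<j) s≤j∸p))
    where
    s+p≤j : s + p ≤ j
    s+p≤j = ≮⇒≥ j≮s+p
    p≤j : p ≤ j
    p≤j = ≤-trans (m≤n+m p s) s+p≤j
    s≤j∸p : s ≤ j ∸ p
    s≤j∸p = m+n≤o⇒m≤o∸n s s+p≤j
    j∸p<j : j ∸ p < j
    j∸p<j = ∸-monoʳ-< 1≤p p≤j

  from-below : ∀ k j → s ≤ j + k → P j
  from-below k j s≤j+k with s ≤? j
  ... | yes s≤j = from-above j (<-wellFounded j) s≤j
  from-below zero j s≤j+0 | no s≰j = contradiction (subst (s ≤_) (+-identityʳ j) s≤j+0) s≰j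
  from-below (suc k) j s≤j+1+k | no s≰j = down j (≰⇒> s≰j) (from-below k (j + p) s≤j+p+k)
    where
    s≤j+p+k : s ≤ j + p + k
    s≤j+p+k = ≤-trans s≤j+1+k
                (subst (_≤ j + p + k) (+-assoc j 1 k) (+-monoˡ-≤ k (+-monoʳ-≤ j 1≤p)))

sum-of-thirds : ∀ {m x y z} → 3 * x ≤ m → 3 * y ≤ m → 3 * z ≤ m → x + y + z ≤ m
sum-of-thirds {m} {x} {y} {z} 3x≤m 3y≤m 3z≤m = *-cancelˡ-≤ 3 (begin
  3 * (x + y + z)        ≡⟨ distribute x y z ⟩
  3 * x + 3 * y + 3 * z  ≤⟨ +-mono-≤ (+-mono-≤ 3x≤m 3y≤m) 3z≤m ⟩
  m + m + m              ≡⟨ triple m ⟩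
  3 * m                  ∎)
  where
  open ≤-Reasoning
  distribute : ∀ x y z → 3 * (x + y + z) ≡ 3 * x + 3 * y + 3 * z
  distribute = solve-∀
  triple : ∀ m → m + m + m ≡ 3 * m
  triple = solve-∀

window-fits : ∀ {n τ i} → τ ≤ n → i ≤ n + 1 ∸ τ → i + τ ≤ suc n
window-fits {n} {τ} {i} τ≤n i≤n+1-τ = begin
  i + τ          ≤⟨ +-monoˡ-≤ τ i≤n+1-τ ⟩
  n + 1 ∸ τ + τ  ≡⟨ m∸n+n≡m (≤-trans τ≤n (m≤m+n n 1)) ⟩
  n + 1          ≡⟨ +-comm n 1 ⟩
  suc n          ∎
  where open ≤-Reasoning

window-overlap : ∀ {a b p q τ} → a ≤ b → 3 * p ≤ τ → 3 * q ≤ τ → 3 * (b + 1 ∸ a) ≤ τ →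
  b + p + q ≤ a + τ
window-overlap {a} {b} {p} {q} {τ} a≤b 3p≤τ 3q≤τ 3w≤τ = begin
  b + p + q                ≡⟨ cong (λ x → x + p + q) (sym (m+[n∸m]≡n a≤b)) ⟩
  a + (b ∸ a) + p + q      ≡⟨ cong (_+ q) (+-assoc a (b ∸ a) p) ⟩
  a + (b ∸ a + p) + q      ≡⟨ +-assoc a (b ∸ a + p) q ⟩
  a + (b ∸ a + p + q)      ≤⟨ +-monoʳ-≤ a (+-monoˡ-≤ q (+-monoˡ-≤ p (∸-monoˡ-≤ a (m≤m+n b 1)))) ⟩
  a + (b + 1 ∸ a + p + q)  ≤⟨ +-monoʳ-≤ a (sum-of-thirds {x = b + 1 ∸ a} 3w≤τ 3p≤τ 3q≤τ) ⟩
  a + τ                    ∎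
  where open ≤-Reasoning

module _ {A : Set} {n : ℕ} (T : Fin n → A) where

  SameChar : ℕ → ℕ → Set
  SameChar j k = (h₁ : j ∸ 1 < n) (h₂ : k ∸ 1 < n) → T (fromℕ< h₁) ≡ T (fromℕ< h₂)

  -- d is a period of T[s .. e), without the side conditions 1 ≤ d ≤ e - s;
  -- the last component of IsPeriod T i len p is definitionally PeriodicOn i (i + len) p.
  PeriodicOn : (s e d : ℕ) → Set
  PeriodicOn s e d = ∀ j → s ≤ j → j + d < e → SameChar j (j + d)

  PeriodicOn-⊆ : ∀ {s e s′ e′ d} → s ≤ s′ → e′ ≤ e → PeriodicOn s e d → PeriodicOn s′ e′ d
  PeriodicOn-⊆ s≤s′ e′≤e periodic j s′≤j j+d<e′ =
    periodic j (≤-trans s≤s′ s′≤j) (<-≤-trans j+d<e′ e′≤e)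

  PeriodicOn-∪ : ∀ {s e s′ e′ p} → s′ + p ≤ e →
    PeriodicOn s e p → PeriodicOn s′ e′ p → PeriodicOn s e′ p
  PeriodicOn-∪ {e = e} {s′} {p = p} s′+p≤e periodic periodic′ j s≤j j+p<e′ with j + p <? e
  ... | yes j+p<e = periodic j s≤j j+p<e
  ... | no j+p≮e = periodic′ j (+-cancelʳ-≤ p s′ j (≤-trans s′+p≤e (≮⇒≥ j+p≮e))) j+p<e′

  module _ {s e p : ℕ} (1≤s : 1 ≤ s) (e≤1+n : e ≤ suc n) (periodic : PeriodicOn s e p) where

    in-range : ∀ {k} → s ≤ k → k < e → k ∸ 1 < n
    in-range s≤k k<e = ∸-monoˡ-< (<-≤-trans k<e e≤1+n) (≤-trans 1≤s s≤k)

    period-after : ∀ {j d} → s ≤ j → j + p + d < e → SameChar (j + d) (j + p + d)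
    period-after {j} {d} s≤j j+p+d<e =
      subst (SameChar (j + d)) (xy∙z≈xz∙y j d p)
        (periodic (j + d) (≤-trans s≤j (m≤m+n j d)) (subst (_< e) (sym (xy∙z≈xz∙y j d p)) j+p+d<e))

    module _ {j d : ℕ} (s≤j : s ≤ j) (j+p+d<e : j + p + d < e) where

      private
        j+p<e : j + p < e
        j+p<e = ≤-<-trans (m≤m+n (j + p) d) j+p+d<e
        j+d<e : j + d < e
        j+d<e = ≤-<-trans (+-monoˡ-≤ d (m≤m+n j p)) j+p+d<e
        hⱼ : j ∸ 1 < n
        hⱼ = in-range s≤j (≤-<-trans (m≤m+n j p) j+p<e)
        hⱼ₊d : (j + d) ∸ 1 < n
        hⱼ₊d = in-range (≤-trans s≤j (m≤m+n j d)) j+d<e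
        hⱼ₊p : (j + p) ∸ 1 < n
        hⱼ₊p = in-range (≤-trans s≤j (m≤m+n j p)) j+p<e
        hⱼ₊p₊d : (j + p + d) ∸ 1 < n
        hⱼ₊p₊d = in-range (≤-trans s≤j (≤-trans (m≤m+n j p) (m≤m+n (j + p) d))) j+p+d<e

      shift-up : SameChar j (j + d) → SameChar (j + p) (j + p + d)
      shift-up same h₁ h₂ = begin
        T (fromℕ< h₁)    ≡⟨ sym (periodic j s≤j j+p<e hⱼ h₁) ⟩
        T (fromℕ< hⱼ)    ≡⟨ same hⱼ hⱼ₊d ⟩
        T (fromℕ< hⱼ₊d)  ≡⟨ period-after s≤j j+p+d<e hⱼ₊d h₂ ⟩
        T (fromℕ< h₂)    ∎
        where open ≡-Reasoning

      shift-down : SameChar (j + p) (j + p + d) → SameChar j (j + d)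
      shift-down same h₁ h₂ = begin
        T (fromℕ< h₁)      ≡⟨ periodic j s≤j j+p<e h₁ hⱼ₊p ⟩
        T (fromℕ< hⱼ₊p)    ≡⟨ same hⱼ₊p hⱼ₊p₊d ⟩
        T (fromℕ< hⱼ₊p₊d)  ≡⟨ sym (period-after s≤j j+p+d<e h₂ hⱼ₊p₊d) ⟩
        T (fromℕ< h₂)      ∎
        where open ≡-Reasoning

    PeriodicOn-extend : ∀ {s′ e′ d} → 1 ≤ p → s ≤ s′ → e′ ≤ e → s′ + p + d ≤ e′ →
      PeriodicOn s′ e′ d → PeriodicOn s e d
    PeriodicOn-extend {s′} {e′} {d} 1≤p s≤s′ e′≤e s′+p+d≤e′ periodic′ =
      block-induction Good s′ p 1≤p block up down
      where
      Good : ℕ → Set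
      Good j = s ≤ j → j + d < e → SameChar j (j + d)

      block : ∀ j → s′ ≤ j → j < s′ + p → Good j
      block j s′≤j j<s′+p _ _ = periodic′ j s′≤j (<-≤-trans (+-monoˡ-< d j<s′+p) s′+p+d≤e′)

      up : ∀ j → s′ ≤ j → Good j → Good (j + p)
      up j s′≤j good _ j+p+d<e = shift-up s≤j j+p+d<e (good s≤j j+d<e)
        where
        s≤j : s ≤ j
        s≤j = ≤-trans s≤s′ s′≤j
        j+d<e : j + d < e
        j+d<e = ≤-<-trans (+-monoˡ-≤ d (m≤m+n j p)) j+p+d<e

      down : ∀ j → j < s′ → Good (j + p) → Good j
      down j j<s′ good s≤j _ = shift-down s≤j j+p+d<e (good (≤-trans s≤j (m≤m+n j p)) j+p+d<e)
        where
        j+p+d<e : j + p + d < e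
        j+p+d<e = <-≤-trans (+-monoˡ-< d (+-monoˡ-< p j<s′)) (≤-trans s′+p+d≤e′ e′≤e)

  IsPer-overlap-≡ : ∀ {L i j p q} → 1 ≤ i → j + L ≤ suc n → i ≤ j → j + p + q ≤ i + L →
    IsPer T i L p → IsPer T j L q → p ≡ q
  IsPer-overlap-≡ {L} {i} {j} {p} {q} 1≤i j+L≤1+n i≤j long-overlap
    ((1≤p , p≤L , periodic-i) , minimal-i) ((1≤q , q≤L , periodic-j) , minimal-j) =
    ≤-antisym (minimal-i q (1≤q , q≤L , q-on-i)) (minimal-j p (1≤p , p≤L , p-on-j))
    where
    i+L≤j+L : i + L ≤ j + L
    i+L≤j+L = +-monoˡ-≤ L i≤j
    q-on-i : PeriodicOn i (i + L) q
    q-on-i = PeriodicOn-extend 1≤i (≤-trans i+L≤j+L j+L≤1+n) periodic-i 1≤p i≤j ≤-refl long-overlap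
               (PeriodicOn-⊆ ≤-refl i+L≤j+L periodic-j)
    p-on-j : PeriodicOn j (j + L) p
    p-on-j = PeriodicOn-extend (≤-trans 1≤i i≤j) j+L≤1+n periodic-j 1≤q ≤-refl i+L≤j+L
               (subst (_≤ i + L) (xy∙z≈xz∙y j p q) long-overlap) (PeriodicOn-⊆ i≤j ≤-refl periodic-i)

  IsPer-between : ∀ {L i j k p} → 1 ≤ i → j + L ≤ suc n → i ≤ k → k ≤ j → j + p + p ≤ i + L →
    IsPer T i L p → IsPeriod T j L p → IsPer T k L p
  IsPer-between {L} {i} {j} {k} {p} 1≤i j+L≤1+n i≤k k≤j long-overlap
    ((1≤p , p≤L , periodic-i) , minimal-i) (_ , _ , periodic-j) =
    (1≤p , p≤L , periodic-k) , minimal-k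
    where
    k+L≤j+L : k + L ≤ j + L
    k+L≤j+L = +-monoˡ-≤ L k≤j
    i+L≤k+L : i + L ≤ k + L
    i+L≤k+L = +-monoˡ-≤ L i≤k
    periodic-k : PeriodicOn k (k + L) p
    periodic-k = PeriodicOn-⊆ i≤k k+L≤j+L
                   (PeriodicOn-∪ (≤-trans (m≤m+n (j + p) p) long-overlap) periodic-i periodic-j)
    minimal-k : ∀ p′ → IsPeriod T k L p′ → p ≤ p′
    minimal-k p′ (1≤p′ , p′≤L , periodic′) with ≤-total p p′
    ... | inj₁ p≤p′ = p≤p′
    ... | inj₂ p′≤p = minimal-i p′ (1≤p′ , p′≤L , p′-on-i)
      where
      p′-on-i : PeriodicOn i (i + L) p′
      p′-on-i = PeriodicOn-extend 1≤i (≤-trans i+L≤k+L (≤-trans k+L≤j+L j+L≤1+n)) periodic-i 1≤p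
                  i≤k ≤-refl (≤-trans (+-mono-≤ (+-monoˡ-≤ p k≤j) p′≤p) long-overlap)
                  (PeriodicOn-⊆ ≤-refl i+L≤k+L periodic′)

lemma3p4 : {A : Set} (n : ℕ) (T : Fin n → A) (τ : ℕ) →
    1 ≤ τ → 2 * τ ≤ n →
    (l r : ℕ) → 1 ≤ l → r ≤ n + 1 ∸ τ → 3 * (r + 1 ∸ l) ≤ τ →
    (a b c : ℕ) → l ≤ a → a ≤ c → c ≤ b → b ≤ r →
    InQ T τ a → InQ T τ b → InQ T τ c
lemma3p4 n T τ _ 2τ≤n l r _ _ 3w≤τ a b c l≤a a≤c c≤b b≤r
  (1≤a , _ , p , per-a , 3p≤τ) (_ , b≤n+1-τ , q , per-b@(period-b , _) , 3q≤τ) =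
  ≤-trans 1≤a a≤c , ≤-trans c≤b b≤n+1-τ , p ,
  IsPer-between T 1≤a fits-b a≤c c≤b long-overlap-p per-a period-b-p , 3p≤τ
  where
  a≤b : a ≤ b
  a≤b = ≤-trans a≤c c≤b
  fits-b : b + τ ≤ suc n
  fits-b = window-fits (m+n≤o⇒m≤o τ 2τ≤n) b≤n+1-τ
  3width≤τ : 3 * (b + 1 ∸ a) ≤ τ
  3width≤τ = ≤-trans (*-monoʳ-≤ 3 (∸-mono (+-monoˡ-≤ 1 b≤r) l≤a)) 3w≤τ
  long-overlap : b + p + q ≤ a + τ
  long-overlap = window-overlap a≤b 3p≤τ 3q≤τ 3width≤τ
  p≡q : p ≡ q
  p≡q = IsPer-overlap-≡ T 1≤a fits-b a≤b long-overlap per-a per-b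
  long-overlap-p : b + p + p ≤ a + τ
  long-overlap-p = subst (λ x → b + p + x ≤ a + τ) (sym p≡q) long-overlap
  period-b-p : IsPeriod T b τ p
  period-b-p = subst (IsPeriod T b τ) (sym p≡q) period-b
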